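{- Let $p$ be a prime, $n\ge1$, $\zeta_n$ a primitive $p^n$-th root of unity and $R_n=\mathbb{Z}[\zeta_n,\tfrac1p]$. For any $x,y\in\mathbb{Z}/p^n\mathbb{Z}$ with $x\neq0$, one has $\{1-\zeta_n^x,\zeta_n^y\}=0$ in $K_2^M(R_n)$.
   Context: For a commutative ring $R$, Milnor's $K_2^M(R)=(R^\times\otimes_{\mathbb{Z}}R^\times)/I_2$, where $I_2$ is the subgroup generated by all $a_1\otimes a_2$ with $a_1+a_2\in\{0,1\}$; the image of $a\otimes b$ is the Steinberg symbol $\{a,b\}$, and the group law is written additively. (For $x\ne0$ in $\mathbb{Z}/p^n\mathbb{Z}$, $1-\zeta_n^x$ is a unit of $R_n$.) -}

module Defs where

open import Data.Nat as ℕ using (ℕ; zero; suc; _∸_)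
open import Data.Integer as ℤ using (ℤ; +_; -_)
open import Data.List using (List; []; _∷_; replicate; _++_; upTo; foldr; map)
open import Data.Product using (Σ; ∃; ∃-syntax; _×_; _,_)
open import Data.Sum using (_⊎_)
open import Relation.Binary.PropositionalEquality using (_≡_)

-- Integer polynomials Z[X], as coefficient lists (index i = coeff of X^i).

Poly : Set
Poly = List ℤ

infixl 6 _+ₚ_
infixl 7 _*ₚ_ _·ₚ_

_+ₚ_ : Poly → Poly → Poly
[]       +ₚ g        = g
(a ∷ f)  +ₚ []       = a ∷ f
(a ∷ f)  +ₚ (b ∷ g)  = (a ℤ.+ b) ∷ (f +ₚ g)

_·ₚ_ : ℤ → Poly → Poly
c ·ₚ f = map (c ℤ.*_) f

negₚ : Poly → Poly
negₚ f = (- + 1) ·ₚ f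

_*ₚ_ : Poly → Poly → Poly
[]      *ₚ g = []
(a ∷ f) *ₚ g = (a ·ₚ g) +ₚ (+ 0 ∷ (f *ₚ g))

coeff : Poly → ℕ → ℤ
coeff []       _       = + 0
coeff (a ∷ f)  zero    = a
coeff (a ∷ f)  (suc i) = coeff f i

-- equality of polynomials (coefficientwise; insensitive to trailing zeros)
infix 4 _≐_
_≐_ : Poly → Poly → Set
f ≐ g = ∀ i → coeff f i ≡ coeff g i

X^ : ℕ → Poly
X^ k = replicate k (+ 0) ++ (+ 1 ∷ [])

-- The ring R_n = Z[ζ_n, 1/p] = Z[X]/(Φ_{p^n}(X)) [1/p], with ζ_n = class of X.
-- Φ_{p^n}(X) = Σ_{i<p} X^{i·p^{n-1}} is the p^n-th cyclotomic polynomial.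

module Cyclo (p n : ℕ) where

  Φ : Poly
  Φ = foldr (λ i acc → X^ (i ℕ.* (p ℕ.^ (n ∸ 1))) +ₚ acc) [] (upTo p)

  pow : ℕ → ℤ
  pow k = + (p ℕ.^ k)

  record R : Set where
    constructor _/p^_
    field
      num : Poly
      den : ℕ
  open R public

  infix 4 _≈_
  _≈_ : R → R → Set
  (f /p^ k) ≈ (g /p^ l) =
    ∃[ m ] ∃[ h ] ((pow m ·ₚ ((pow l ·ₚ f) +ₚ negₚ (pow k ·ₚ g))) ≐ (h *ₚ Φ))

  infixl 6 _+R_ _-R_
  infixl 7 _*R_

  _+R_ : R → R → R
  (f /p^ k) +R (g /p^ l) = ((pow l ·ₚ f) +ₚ (pow k ·ₚ g)) /p^ (k ℕ.+ l)

  -R_ : R → R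
  -R (f /p^ k) = negₚ f /p^ k

  _-R_ : R → R → R
  a -R b = a +R (-R b)

  _*R_ : R → R → R
  (f /p^ k) *R (g /p^ l) = (f *ₚ g) /p^ (k ℕ.+ l)

  0R 1R : R
  0R = [] /p^ 0
  1R = (+ 1 ∷ []) /p^ 0

  ζ^ : ℕ → R
  ζ^ k = X^ k /p^ 0

  IsUnit : R → Set
  IsUnit a = Σ R λ b → (a *R b) ≈ 1R

  record Unit : Set where
    constructor unit
    field
      elt   : R
      isU   : IsUnit elt
  open Unit public

  -- Milnor K_2^M(R_n) = (R^× ⊗_Z R^×) / I_2, presented as the free abelian
  -- group on pairs of units modulo: well-definedness on units (≈),
  -- bilinearity in each variable (the tensor product relations), and the
  -- generators a₁ ⊗ a₂ of I_2 with a₁ + a₂ ∈ {0, 1}.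

  data K2Expr : Set where
    sym⟨_,_⟩ : Unit → Unit → K2Expr
    𝟘       : K2Expr
    _⊕_     : K2Expr → K2Expr → K2Expr
    ⊖_      : K2Expr → K2Expr

  infix 4 _∼_
  infixl 6 _⊕_

  data _∼_ : K2Expr → K2Expr → Set where
    ∼-refl  : ∀ {e} → e ∼ e
    ∼-sym   : ∀ {e e'} → e ∼ e' → e' ∼ e
    ∼-trans : ∀ {e e' e''} → e ∼ e' → e' ∼ e'' → e ∼ e''
    ⊕-cong  : ∀ {e₁ e₂ e₁' e₂'} → e₁ ∼ e₁' → e₂ ∼ e₂' → e₁ ⊕ e₂ ∼ e₁' ⊕ e₂'
    ⊖-cong  : ∀ {e e'} → e ∼ e' → ⊖ e ∼ ⊖ e'
    ⊕-assoc : ∀ e₁ e₂ e₃ → (e₁ ⊕ e₂) ⊕ e₃ ∼ e₁ ⊕ (e₂ ⊕ e₃)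
    ⊕-comm  : ∀ e₁ e₂ → e₁ ⊕ e₂ ∼ e₂ ⊕ e₁
    ⊕-idˡ   : ∀ e → 𝟘 ⊕ e ∼ e
    ⊖-invˡ  : ∀ e → (⊖ e) ⊕ e ∼ 𝟘
    sym-cong : ∀ a a' b b' → elt a ≈ elt a' → elt b ≈ elt b' →
               sym⟨ a , b ⟩ ∼ sym⟨ a' , b' ⟩
    bilinˡ : ∀ a b c d → elt d ≈ (elt a *R elt b) →
             sym⟨ d , c ⟩ ∼ sym⟨ a , c ⟩ ⊕ sym⟨ b , c ⟩
    bilinʳ : ∀ a b c d → elt d ≈ (elt a *R elt b) →
             sym⟨ c , d ⟩ ∼ sym⟨ c , a ⟩ ⊕ sym⟨ c , b ⟩
    steinberg : ∀ a b → ((elt a +R elt b) ≈ 0R) ⊎ ((elt a +R elt b) ≈ 1R) →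
                sym⟨ a , b ⟩ ∼ 𝟘

-- Bilinearity makes "{c, z} = 0" a subgroup condition on z, and {1 − ζˢ, ζˢ} = 0 is a Steinberg
-- relation; hence {1 − ζˢ, ζ} = 0 whenever p ∤ s, for then ζˢ generates the p^n-th roots of unity.
-- If s = p s₁, put ω = ζ^(p^(n−1)): then 1 − ζˢ = ∏_{j<p} (1 − ωʲ ζ^s₁), whose factors are
-- 1 − ζᵗ with t = j p^(n−1) + s₁ of smaller p-adic valuation than s.  Induction on the valuation
-- gives {1 − ζˢ, ζ} = 0 for every s ≢ 0 mod p^n, and then {1 − ζˣ, ζʸ} = y {1 − ζˣ, ζ} = 0.
--
-- The factorisation ∏_{j<p} (1 − ωʲT) = 1 − Tᵖ only needs 1 + ω + ⋯ + ω^(p−1) = 0 and p to be a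
-- non-zero-divisor.  The product P(T) satisfies P(ωT) = P(T), so its i-th coefficient is fixed
-- by ωⁱ; for 0 < i < p this forces it to vanish (ωⁱ generates ⟨ω⟩, and summing a fixed element
-- over ⟨ω⟩ multiplies it by p).  P(1) = 0 then determines the top coefficient.  All of this is
-- computed in ℤ[X] modulo the p-saturation of (Φ), the image of ℤ[X] in R_n = ℤ[X, 1/p]/(Φ).

{-# OPTIONS --safe #-}
module Submission where

open import Defs
open import Data.Nat as ℕ using (ℕ; zero; suc; _≤_; _<_; s≤s; z≤n)
import Data.Nat.Properties as ℕ
open import Data.Nat.Divisibility
  using (_∣_; divides; _∣?_; 1∣_; ∣1⇒≡1; ∣-trans; *-monoʳ-∣; ∣m+n∣m⇒∣n; ∣n⇒∣m*n; ∣⇒≤)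
open import Data.Nat.Coprimality using (Coprime; coprime-divisor; coprime-Bézout; prime⇒coprime)
open import Data.Nat.GCD using (module Bézout)
open import Data.Nat.Primality using (Prime; prime⇒irreducible; prime⇒nonZero)
open import Data.Integer as ℤ using (ℤ; +_; -_)
import Data.Integer.Properties as ℤ
open import Data.Fin as Fin using (Fin; toℕ)
open import Data.Fin.Properties using (toℕ<n)
open import Data.List using ([]; _∷_; foldr; applyUpTo)
open import Data.Maybe using (Maybe; just; nothing)
open import Data.Product using (∃-syntax; _,_)
open import Data.Sum using (inj₁; inj₂)
open import Function using (_∘_)
open import Relation.Nullary using (¬_; yes; no; contradiction)
open import Relation.Binary.PropositionalEquality using (_≡_; _≢_; refl; sym; trans; cong; cong₂; subst; module ≡-Reasoning)
open import Relation.Binary.Bundles using (Setoid)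
import Relation.Binary.Reasoning.Setoid as SetoidReasoning
open import Algebra.Bundles using (CommutativeRing; AbelianGroup)
open import Tactic.RingSolver.Core.AlmostCommutativeRing using (AlmostCommutativeRing; fromCommutativeRing)
open import Tactic.RingSolver using (solve-∀)

prime∤⇒coprime : ∀ {p s} → Prime p → ¬ p ∣ s → Coprime p s
prime∤⇒coprime p-prime p∤s (d∣p , d∣s) with prime⇒irreducible p-prime d∣p
... | inj₁ d≡1 = d≡1
... | inj₂ refl = contradiction d∣s p∤s

coprime-^ : ∀ {a b} → Coprime a b → ∀ k → Coprime (a ℕ.^ k) b
coprime-^ a⊥b zero    (d∣1 , _)     = ∣1⇒≡1 d∣1
coprime-^ {a} a⊥b (suc k) {d} (d∣aaᵏ , d∣b) = coprime-^ a⊥b k (coprime-divisor d⊥a d∣aaᵏ , d∣b)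
  where
  d⊥a : Coprime d a
  d⊥a (e∣d , e∣a) = a⊥b (e∣a , ∣-trans e∣d d∣b)

^-monoʳ-∣ : ∀ p {a b} → a ≤ b → p ℕ.^ a ∣ p ℕ.^ b
^-monoʳ-∣ p {b = b} z≤n   = 1∣ (p ℕ.^ b)
^-monoʳ-∣ p (s≤s a≤b) = *-monoʳ-∣ p (^-monoʳ-∣ p a≤b)

infixl 6 _-ₚ_
_-ₚ_ : Poly → Poly → Poly
f -ₚ g = f +ₚ negₚ g

1ₚ : Poly
1ₚ = + 1 ∷ []

C : ℤ → Poly
C c = c ∷ []

-- A record rather than f ≐ g itself, so that f and g can be inferred from a proof.
infix 4 _≋_
record _≋_ (f g : Poly) : Set where
  constructor coeffwise
  field coeff-≡ : f ≐ g
open _≋_ public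

≋-refl : ∀ {f} → f ≋ f
≋-refl = coeffwise λ _ → refl

≋-sym : ∀ {f g} → f ≋ g → g ≋ f
≋-sym (coeffwise e) = coeffwise λ i → sym (e i)

≋-trans : ∀ {f g h} → f ≋ g → g ≋ h → f ≋ h
≋-trans (coeffwise e) (coeffwise e′) = coeffwise λ i → trans (e i) (e′ i)

≋-setoid : Setoid _ _
≋-setoid = record
  { Carrier = Poly ; _≈_ = _≋_ ; isEquivalence = record { refl = ≋-refl ; sym = ≋-sym ; trans = ≋-trans } }

module ≋-Reasoning = SetoidReasoning ≋-setoid

≡⇒≋ : ∀ {f g} → f ≡ g → f ≋ g
≡⇒≋ refl = ≋-refl

∷-cong : ∀ {a b f g} → a ≡ b → f ≋ g → a ∷ f ≋ b ∷ g
∷-cong a≡b (coeffwise e) = coeffwise λ { zero → a≡b ; (suc i) → e i }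

∷-zero : ∀ {a f} → a ≡ + 0 → f ≋ [] → a ∷ f ≋ []
∷-zero a≡0 (coeffwise e) = coeffwise λ { zero → a≡0 ; (suc i) → e i }

coeff-+ₚ : ∀ f g i → coeff (f +ₚ g) i ≡ coeff f i ℤ.+ coeff g i
coeff-+ₚ []      g       i       = sym (ℤ.+-identityˡ _)
coeff-+ₚ (a ∷ f) []      i       = sym (ℤ.+-identityʳ _)
coeff-+ₚ (a ∷ f) (b ∷ g) zero    = refl
coeff-+ₚ (a ∷ f) (b ∷ g) (suc i) = coeff-+ₚ f g i

coeff-·ₚ : ∀ c f i → coeff (c ·ₚ f) i ≡ c ℤ.* coeff f i
coeff-·ₚ c []      i       = sym (ℤ.*-zeroʳ c)
coeff-·ₚ c (a ∷ f) zero    = refl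
coeff-·ₚ c (a ∷ f) (suc i) = coeff-·ₚ c f i

+ₚ-cong : ∀ {f f′ g g′} → f ≋ f′ → g ≋ g′ → f +ₚ g ≋ f′ +ₚ g′
+ₚ-cong {f} {f′} {g} {g′} (coeffwise e) (coeffwise e′) = coeffwise λ i →
  trans (coeff-+ₚ f g i) (trans (cong₂ ℤ._+_ (e i) (e′ i)) (sym (coeff-+ₚ f′ g′ i)))

·ₚ-congʳ : ∀ c {f g} → f ≋ g → c ·ₚ f ≋ c ·ₚ g
·ₚ-congʳ c {f} {g} (coeffwise e) = coeffwise λ i →
  trans (coeff-·ₚ c f i) (trans (cong (c ℤ.*_) (e i)) (sym (coeff-·ₚ c g i)))

+ₚ-assoc : ∀ f g h → (f +ₚ g) +ₚ h ≡ f +ₚ (g +ₚ h)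
+ₚ-assoc []      g       h       = refl
+ₚ-assoc (a ∷ f) []      h       = refl
+ₚ-assoc (a ∷ f) (b ∷ g) []      = refl
+ₚ-assoc (a ∷ f) (b ∷ g) (c ∷ h) = cong₂ _∷_ (ℤ.+-assoc a b c) (+ₚ-assoc f g h)

+ₚ-comm : ∀ f g → f +ₚ g ≡ g +ₚ f
+ₚ-comm []      []      = refl
+ₚ-comm []      (b ∷ g) = refl
+ₚ-comm (a ∷ f) []      = refl
+ₚ-comm (a ∷ f) (b ∷ g) = cong₂ _∷_ (ℤ.+-comm a b) (+ₚ-comm f g)

+ₚ-identityʳ : ∀ f → f +ₚ [] ≡ f
+ₚ-identityʳ []      = refl
+ₚ-identityʳ (a ∷ f) = refl

+ₚ-interchange : ∀ f g h k → (f +ₚ g) +ₚ (h +ₚ k) ≡ (f +ₚ h) +ₚ (g +ₚ k)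
+ₚ-interchange f g h k = begin
  (f +ₚ g) +ₚ (h +ₚ k)  ≡⟨ +ₚ-assoc f g (h +ₚ k) ⟩
  f +ₚ (g +ₚ (h +ₚ k))  ≡⟨ cong (f +ₚ_) (sym (+ₚ-assoc g h k)) ⟩
  f +ₚ ((g +ₚ h) +ₚ k)  ≡⟨ cong (λ x → f +ₚ (x +ₚ k)) (+ₚ-comm g h) ⟩
  f +ₚ ((h +ₚ g) +ₚ k)  ≡⟨ cong (f +ₚ_) (+ₚ-assoc h g k) ⟩
  f +ₚ (h +ₚ (g +ₚ k))  ≡⟨ sym (+ₚ-assoc f h (g +ₚ k)) ⟩
  (f +ₚ h) +ₚ (g +ₚ k)  ∎
  where open ≡-Reasoning

negₚ-inverseˡ : ∀ f → negₚ f +ₚ f ≋ []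
negₚ-inverseˡ []      = ≋-refl
negₚ-inverseˡ (a ∷ f) =
  ∷-zero (trans (cong (ℤ._+ a) (ℤ.-1*i≡-i a)) (ℤ.+-inverseˡ a)) (negₚ-inverseˡ f)

·ₚ-distribˡ : ∀ c f g → c ·ₚ (f +ₚ g) ≡ c ·ₚ f +ₚ c ·ₚ g
·ₚ-distribˡ c []      g       = refl
·ₚ-distribˡ c (a ∷ f) []      = refl
·ₚ-distribˡ c (a ∷ f) (b ∷ g) = cong₂ _∷_ (ℤ.*-distribˡ-+ c a b) (·ₚ-distribˡ c f g)

·ₚ-assoc : ∀ c d f → c ·ₚ (d ·ₚ f) ≡ (c ℤ.* d) ·ₚ f
·ₚ-assoc c d []      = refl
·ₚ-assoc c d (a ∷ f) = cong₂ _∷_ (sym (ℤ.*-assoc c d a)) (·ₚ-assoc c d f)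

·ₚ-identity : ∀ f → + 1 ·ₚ f ≡ f
·ₚ-identity []      = refl
·ₚ-identity (a ∷ f) = cong₂ _∷_ (ℤ.*-identityˡ a) (·ₚ-identity f)

·ₚ-zero : ∀ f → + 0 ·ₚ f ≋ []
·ₚ-zero []      = ≋-refl
·ₚ-zero (a ∷ f) = ∷-zero refl (·ₚ-zero f)

*ₚ-zeroʳ : ∀ f → f *ₚ [] ≋ []
*ₚ-zeroʳ []      = ≋-refl
*ₚ-zeroʳ (a ∷ f) = ∷-zero refl (*ₚ-zeroʳ f)

0∷-*ₚ : ∀ f g → (+ 0 ∷ f) *ₚ g ≋ + 0 ∷ f *ₚ g
0∷-*ₚ f g = +ₚ-cong (·ₚ-zero g) ≋-refl

*ₚ-∷ʳ : ∀ f a g → f *ₚ (a ∷ g) ≋ a ·ₚ f +ₚ (+ 0 ∷ f *ₚ g)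
*ₚ-∷ʳ []      a g = ≋-sym (∷-zero refl ≋-refl)
*ₚ-∷ʳ (b ∷ f) a g = ∷-cong (cong (ℤ._+ + 0) (ℤ.*-comm b a)) (begin
  b ·ₚ g +ₚ f *ₚ (a ∷ g)                 ≈⟨ +ₚ-cong ≋-refl (*ₚ-∷ʳ f a g) ⟩
  b ·ₚ g +ₚ (a ·ₚ f +ₚ (+ 0 ∷ f *ₚ g))  ≡⟨ sym (+ₚ-assoc (b ·ₚ g) (a ·ₚ f) _) ⟩
  (b ·ₚ g +ₚ a ·ₚ f) +ₚ (+ 0 ∷ f *ₚ g)  ≡⟨ cong (_+ₚ (+ 0 ∷ f *ₚ g)) (+ₚ-comm (b ·ₚ g) (a ·ₚ f)) ⟩
  (a ·ₚ f +ₚ b ·ₚ g) +ₚ (+ 0 ∷ f *ₚ g)  ≡⟨ +ₚ-assoc (a ·ₚ f) (b ·ₚ g) _ ⟩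
  a ·ₚ f +ₚ (b ·ₚ g +ₚ (+ 0 ∷ f *ₚ g))  ∎)
  where open ≋-Reasoning

*ₚ-comm : ∀ f g → f *ₚ g ≋ g *ₚ f
*ₚ-comm []      g = ≋-sym (*ₚ-zeroʳ g)
*ₚ-comm (a ∷ f) g = ≋-trans (+ₚ-cong ≋-refl (∷-cong refl (*ₚ-comm f g))) (≋-sym (*ₚ-∷ʳ g a f))

*ₚ-congʳ : ∀ f {g h} → g ≋ h → f *ₚ g ≋ f *ₚ h
*ₚ-congʳ []      g≋h = ≋-refl
*ₚ-congʳ (a ∷ f) g≋h = +ₚ-cong (·ₚ-congʳ a g≋h) (∷-cong refl (*ₚ-congʳ f g≋h))

*ₚ-cong : ∀ {f f′ g g′} → f ≋ f′ → g ≋ g′ → f *ₚ g ≋ f′ *ₚ g′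
*ₚ-cong {f} {f′} {g} {g′} f≋f′ g≋g′ = begin
  f *ₚ g   ≈⟨ *ₚ-congʳ f g≋g′ ⟩
  f *ₚ g′  ≈⟨ *ₚ-comm f g′ ⟩
  g′ *ₚ f  ≈⟨ *ₚ-congʳ g′ f≋f′ ⟩
  g′ *ₚ f′ ≈⟨ *ₚ-comm g′ f′ ⟩
  f′ *ₚ g′ ∎
  where open ≋-Reasoning

*ₚ-distribˡ : ∀ f g h → f *ₚ (g +ₚ h) ≋ f *ₚ g +ₚ f *ₚ h
*ₚ-distribˡ []      g h = ≋-refl
*ₚ-distribˡ (a ∷ f) g h = begin
  a ·ₚ (g +ₚ h) +ₚ (+ 0 ∷ f *ₚ (g +ₚ h))
    ≈⟨ +ₚ-cong (≡⇒≋ (·ₚ-distribˡ a g h)) (∷-cong refl (*ₚ-distribˡ f g h)) ⟩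
  (a ·ₚ g +ₚ a ·ₚ h) +ₚ ((+ 0 ∷ f *ₚ g) +ₚ (+ 0 ∷ f *ₚ h))
    ≡⟨ +ₚ-interchange (a ·ₚ g) (a ·ₚ h) _ _ ⟩
  (a ·ₚ g +ₚ (+ 0 ∷ f *ₚ g)) +ₚ (a ·ₚ h +ₚ (+ 0 ∷ f *ₚ h)) ∎
  where open ≋-Reasoning

*ₚ-distribʳ : ∀ h f g → (f +ₚ g) *ₚ h ≋ f *ₚ h +ₚ g *ₚ h
*ₚ-distribʳ h f g = ≋-trans (*ₚ-comm (f +ₚ g) h)
  (≋-trans (*ₚ-distribˡ h f g) (+ₚ-cong (*ₚ-comm h f) (*ₚ-comm h g)))

·ₚ-*ₚ : ∀ c f g → (c ·ₚ f) *ₚ g ≋ c ·ₚ (f *ₚ g)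
·ₚ-*ₚ c []      g = ≋-refl
·ₚ-*ₚ c (a ∷ f) g = begin
  (c ℤ.* a) ·ₚ g +ₚ (+ 0 ∷ (c ·ₚ f) *ₚ g)
    ≈⟨ +ₚ-cong (≡⇒≋ (sym (·ₚ-assoc c a g))) (∷-cong (sym (ℤ.*-zeroʳ c)) (·ₚ-*ₚ c f g)) ⟩
  c ·ₚ (a ·ₚ g) +ₚ c ·ₚ (+ 0 ∷ f *ₚ g)
    ≡⟨ sym (·ₚ-distribˡ c (a ·ₚ g) _) ⟩
  c ·ₚ (a ·ₚ g +ₚ (+ 0 ∷ f *ₚ g))
    ∎
  where open ≋-Reasoning

*ₚ-assoc : ∀ f g h → (f *ₚ g) *ₚ h ≋ f *ₚ (g *ₚ h)
*ₚ-assoc []      g h = ≋-refl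
*ₚ-assoc (a ∷ f) g h = begin
  (a ·ₚ g +ₚ (+ 0 ∷ f *ₚ g)) *ₚ h          ≈⟨ *ₚ-distribʳ h (a ·ₚ g) _ ⟩
  (a ·ₚ g) *ₚ h +ₚ (+ 0 ∷ f *ₚ g) *ₚ h     ≈⟨ +ₚ-cong (·ₚ-*ₚ a g h) (0∷-*ₚ (f *ₚ g) h) ⟩
  a ·ₚ (g *ₚ h) +ₚ (+ 0 ∷ (f *ₚ g) *ₚ h)   ≈⟨ +ₚ-cong ≋-refl (∷-cong refl (*ₚ-assoc f g h)) ⟩
  a ·ₚ (g *ₚ h) +ₚ (+ 0 ∷ f *ₚ (g *ₚ h))   ∎
  where open ≋-Reasoning

*ₚ-identityˡ : ∀ f → 1ₚ *ₚ f ≋ f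
*ₚ-identityˡ f = ≋-trans (+ₚ-cong (≡⇒≋ (·ₚ-identity f)) (∷-zero refl ≋-refl)) (≡⇒≋ (+ₚ-identityʳ f))

*ₚ-identityʳ : ∀ f → f *ₚ 1ₚ ≋ f
*ₚ-identityʳ f = ≋-trans (*ₚ-comm f _) (*ₚ-identityˡ f)

negₚ-inverseʳ : ∀ f → f +ₚ negₚ f ≋ []
negₚ-inverseʳ f = ≋-trans (≡⇒≋ (+ₚ-comm f (negₚ f))) (negₚ-inverseˡ f)

·ₚ≋C*ₚ : ∀ c f → c ·ₚ f ≋ C c *ₚ f
·ₚ≋C*ₚ c f = ≋-sym (coeffwise λ i → trans (coeff-+ₚ (c ·ₚ f) (C (+ 0)) i)
  (trans (cong (λ x → coeff (c ·ₚ f) i ℤ.+ x) (coeff-C0 i)) (ℤ.+-identityʳ _)))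
  where
  coeff-C0 : ∀ i → coeff (C (+ 0)) i ≡ + 0
  coeff-C0 zero    = refl
  coeff-C0 (suc i) = refl

C-* : ∀ a b → C (a ℤ.* b) ≋ C a *ₚ C b
C-* a b = ∷-cong (sym (ℤ.+-identityʳ _)) ≋-refl

X^-+ : ∀ a b → X^ (a ℕ.+ b) ≋ X^ a *ₚ X^ b
X^-+ zero    b = ≋-sym (*ₚ-identityˡ (X^ b))
X^-+ (suc a) b = ≋-trans (∷-cong refl (X^-+ a b)) (≋-sym (0∷-*ₚ (X^ a) (X^ b)))

ℤ[X] : CommutativeRing _ _
ℤ[X] = record
  { Carrier = Poly ; _≈_ = _≋_ ; _+_ = _+ₚ_ ; _*_ = _*ₚ_ ; -_ = negₚ ; 0# = [] ; 1# = 1ₚ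
  ; isCommutativeRing = record
    { isRing = record
      { +-isAbelianGroup = record
        { isGroup = record
          { isMonoid = record
            { isSemigroup = record
              { isMagma = record { isEquivalence = Setoid.isEquivalence ≋-setoid ; ∙-cong = +ₚ-cong }
              ; assoc = λ f g h → ≡⇒≋ (+ₚ-assoc f g h) }
            ; identity = (λ _ → ≋-refl) , (λ f → ≡⇒≋ (+ₚ-identityʳ f)) }
          ; inverse = negₚ-inverseˡ , negₚ-inverseʳ
          ; ⁻¹-cong = ·ₚ-congʳ (- + 1) }
        ; comm = λ f g → ≡⇒≋ (+ₚ-comm f g) }
      ; *-cong = *ₚ-cong
      ; *-assoc = *ₚ-assoc
      ; *-identity = *ₚ-identityˡ , *ₚ-identityʳ
      ; distrib = *ₚ-distribˡ , *ₚ-distribʳ }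
    ; *-comm = *ₚ-comm } }

-- The ring solver cancels a monomial only when this test recognises its coefficient as zero.
[]≋? : ∀ f → Maybe ([] ≋ f)
[]≋? []      = just ≋-refl
[]≋? (a ∷ f) with a ℤ.≟ + 0 | []≋? f
... | yes a≡0 | just []≋f = just (≋-sym (∷-zero a≡0 (≋-sym []≋f)))
... | _       | _         = nothing

ℤ[X]-solver : AlmostCommutativeRing _ _
ℤ[X]-solver = fromCommutativeRing ℤ[X] []≋?

module Saturation (p : ℕ) (Φ : Poly) where

  pow : ℕ → ℤ
  pow k = + (p ℕ.^ k)

  p^ : ℕ → Poly
  p^ k = C (pow k)

  p^-+ : ∀ a b → p^ (a ℕ.+ b) ≋ p^ a *ₚ p^ b
  p^-+ a b = ≋-trans (≡⇒≋ (cong C pow-+)) (C-* (pow a) (pow b))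
    where
    pow-+ : pow (a ℕ.+ b) ≡ pow a ℤ.* pow b
    pow-+ = trans (cong +_ (ℕ.^-distribˡ-+-* p a b)) (ℤ.pos-* (p ℕ.^ a) (p ℕ.^ b))

  -- 𝔞 = (Φ) : p^∞ is the kernel of ℤ[X] → ℤ[X, 1/p]/(Φ); Cyclo's f/p^k ≈ g/p^l says p^l f − p^k g ∈ 𝔞.
  infix 4 _∈𝔞
  record _∈𝔞 (F : Poly) : Set where
    constructor saturation
    field certificate : ∃[ m ] ∃[ h ] (pow m ·ₚ F ≐ h *ₚ Φ)

  ∈𝔞-intro : ∀ m h F → p^ m *ₚ F ≋ h *ₚ Φ → F ∈𝔞
  ∈𝔞-intro m h F e = saturation (m , h , coeff-≡ (≋-trans (·ₚ≋C*ₚ (pow m) F) e))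

  ∈𝔞-elim : ∀ {F} → F ∈𝔞 → ∃[ m ] ∃[ h ] (p^ m *ₚ F ≋ h *ₚ Φ)
  ∈𝔞-elim {F} (saturation (m , h , e)) = m , h , ≋-trans (≋-sym (·ₚ≋C*ₚ (pow m) F)) (coeffwise e)

  ∈𝔞-resp : ∀ {F G} → F ≋ G → F ∈𝔞 → G ∈𝔞
  ∈𝔞-resp {F} {G} F≋G F∈𝔞 with ∈𝔞-elim F∈𝔞
  ... | m , h , e = ∈𝔞-intro m h G (≋-trans (*ₚ-congʳ (p^ m) (≋-sym F≋G)) e)

  ≋[]⇒∈𝔞 : ∀ {F} → F ≋ [] → F ∈𝔞
  ≋[]⇒∈𝔞 {F} F≋0 = ∈𝔞-intro 0 [] F (≋-trans (*ₚ-congʳ (p^ 0) F≋0) (*ₚ-zeroʳ (p^ 0)))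

  Φ∈𝔞 : Φ ∈𝔞
  Φ∈𝔞 = ∈𝔞-intro 0 (p^ 0) Φ ≋-refl

  +-closed : ∀ {F G} → F ∈𝔞 → G ∈𝔞 → F +ₚ G ∈𝔞
  +-closed {F} {G} F∈𝔞 G∈𝔞 with ∈𝔞-elim F∈𝔞 | ∈𝔞-elim G∈𝔞
  ... | m , h , e | m′ , h′ , e′ = ∈𝔞-intro (m ℕ.+ m′) (p^ m′ *ₚ h +ₚ p^ m *ₚ h′) (F +ₚ G) (begin
    p^ (m ℕ.+ m′) *ₚ (F +ₚ G)                 ≈⟨ *ₚ-cong (p^-+ m m′) ≋-refl ⟩
    (p^ m *ₚ p^ m′) *ₚ (F +ₚ G)                 ≈⟨ split (p^ m) (p^ m′) F G ⟩
    p^ m′ *ₚ (p^ m *ₚ F) +ₚ p^ m *ₚ (p^ m′ *ₚ G)    ≈⟨ +ₚ-cong (*ₚ-congʳ (p^ m′) e) (*ₚ-congʳ (p^ m) e′) ⟩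
    p^ m′ *ₚ (h *ₚ Φ) +ₚ p^ m *ₚ (h′ *ₚ Φ)        ≈⟨ merge (p^ m′) (p^ m) h h′ Φ ⟩
    (p^ m′ *ₚ h +ₚ p^ m *ₚ h′) *ₚ Φ              ∎)
    where
    open ≋-Reasoning
    split : ∀ a b F G → (a *ₚ b) *ₚ (F +ₚ G) ≋ b *ₚ (a *ₚ F) +ₚ a *ₚ (b *ₚ G)
    split = solve-∀ ℤ[X]-solver
    merge : ∀ a b h h′ Φ → a *ₚ (h *ₚ Φ) +ₚ b *ₚ (h′ *ₚ Φ) ≋ (a *ₚ h +ₚ b *ₚ h′) *ₚ Φ
    merge = solve-∀ ℤ[X]-solver

  *-closed : ∀ H {F} → F ∈𝔞 → H *ₚ F ∈𝔞
  *-closed H {F} F∈𝔞 with ∈𝔞-elim F∈𝔞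
  ... | m , h , e = ∈𝔞-intro m (H *ₚ h) (H *ₚ F) (begin
    p^ m *ₚ (H *ₚ F)   ≈⟨ swap (p^ m) H F ⟩
    H *ₚ (p^ m *ₚ F)   ≈⟨ *ₚ-congʳ H e ⟩
    H *ₚ (h *ₚ Φ)     ≈⟨ ≋-sym (*ₚ-assoc H h Φ) ⟩
    (H *ₚ h) *ₚ Φ     ∎)
    where
    open ≋-Reasoning
    swap : ∀ a b c → a *ₚ (b *ₚ c) ≋ b *ₚ (a *ₚ c)
    swap = solve-∀ ℤ[X]-solver

  ∈𝔞-saturated : ∀ j F → p^ j *ₚ F ∈𝔞 → F ∈𝔞
  ∈𝔞-saturated j F pF∈𝔞 with ∈𝔞-elim pF∈𝔞
  ... | m , h , e = ∈𝔞-intro (m ℕ.+ j) h F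
    (≋-trans (*ₚ-cong (p^-+ m j) ≋-refl) (≋-trans (*ₚ-assoc (p^ m) (p^ j) F) e))

  infix 4 _≃_
  record _≃_ (F G : Poly) : Set where
    constructor mod𝔞
    field difference∈𝔞 : F -ₚ G ∈𝔞
  open _≃_ public

  ≋⇒≃ : ∀ {F G} → F ≋ G → F ≃ G
  ≋⇒≃ {F} {G} F≋G = mod𝔞 (≋[]⇒∈𝔞 (≋-trans (+ₚ-cong F≋G ≋-refl) (negₚ-inverseʳ G)))

  ≃-sym : ∀ {F G} → F ≃ G → G ≃ F
  ≃-sym {F} {G} (mod𝔞 d) = mod𝔞 (∈𝔞-resp (negate F G) (*-closed (negₚ 1ₚ) d))
    where
    negate : ∀ F G → (negₚ 1ₚ) *ₚ (F -ₚ G) ≋ G -ₚ F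
    negate = solve-∀ ℤ[X]-solver

  ≃-trans : ∀ {F G H} → F ≃ G → G ≃ H → F ≃ H
  ≃-trans {F} {G} {H} (mod𝔞 d) (mod𝔞 d′) = mod𝔞 (∈𝔞-resp (telescope F G H) (+-closed d d′))
    where
    telescope : ∀ F G H → (F -ₚ G) +ₚ (G -ₚ H) ≋ F -ₚ H
    telescope = solve-∀ ℤ[X]-solver

  ≃-+-cong : ∀ {F F′ G G′} → F ≃ F′ → G ≃ G′ → F +ₚ G ≃ F′ +ₚ G′
  ≃-+-cong {F} {F′} {G} {G′} (mod𝔞 d) (mod𝔞 d′) = mod𝔞 (∈𝔞-resp (regroup F F′ G G′) (+-closed d d′))
    where
    regroup : ∀ F F′ G G′ → (F -ₚ F′) +ₚ (G -ₚ G′) ≋ (F +ₚ G) -ₚ (F′ +ₚ G′)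
    regroup = solve-∀ ℤ[X]-solver

  ≃-*-cong : ∀ {F F′ G G′} → F ≃ F′ → G ≃ G′ → F *ₚ G ≃ F′ *ₚ G′
  ≃-*-cong {F} {F′} {G} {G′} (mod𝔞 d) (mod𝔞 d′) =
    mod𝔞 (∈𝔞-resp (regroup F F′ G G′) (+-closed (*-closed G d) (*-closed F′ d′)))
    where
    regroup : ∀ F F′ G G′ → G *ₚ (F -ₚ F′) +ₚ F′ *ₚ (G -ₚ G′) ≋ F *ₚ G -ₚ (F′ *ₚ G′)
    regroup = solve-∀ ℤ[X]-solver

  ≃-neg-cong : ∀ {F F′} → F ≃ F′ → negₚ F ≃ negₚ F′
  ≃-neg-cong {F} {F′} (mod𝔞 d) = mod𝔞 (∈𝔞-resp (negate F F′) (*-closed (negₚ 1ₚ) d))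
    where
    negate : ∀ F F′ → (negₚ 1ₚ) *ₚ (F -ₚ F′) ≋ negₚ F -ₚ (negₚ F′)
    negate = solve-∀ ℤ[X]-solver

  ℤ[X]/𝔞 : CommutativeRing _ _
  ℤ[X]/𝔞 = record
    { Carrier = Poly ; _≈_ = _≃_ ; _+_ = _+ₚ_ ; _*_ = _*ₚ_ ; -_ = negₚ ; 0# = [] ; 1# = 1ₚ
    ; isCommutativeRing = record
      { isRing = record
        { +-isAbelianGroup = record
          { isGroup = record
            { isMonoid = record
              { isSemigroup = record
                { isMagma = record
                  { isEquivalence = record { refl = ≋⇒≃ ≋-refl ; sym = ≃-sym ; trans = ≃-trans }
                  ; ∙-cong = ≃-+-cong }
                ; assoc = λ F G H → ≋⇒≃ (R.+-assoc F G H) }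
              ; identity = (λ F → ≋⇒≃ (R.+-identityˡ F)) , (λ F → ≋⇒≃ (R.+-identityʳ F)) }
            ; inverse = (λ F → ≋⇒≃ (R.-‿inverseˡ F)) , (λ F → ≋⇒≃ (R.-‿inverseʳ F))
            ; ⁻¹-cong = ≃-neg-cong }
          ; comm = λ F G → ≋⇒≃ (R.+-comm F G) }
        ; *-cong = ≃-*-cong
        ; *-assoc = λ F G H → ≋⇒≃ (R.*-assoc F G H)
        ; *-identity = (λ F → ≋⇒≃ (R.*-identityˡ F)) , (λ F → ≋⇒≃ (R.*-identityʳ F))
        ; distrib = (λ F G H → ≋⇒≃ (R.distribˡ F G H)) , (λ F G H → ≋⇒≃ (R.distribʳ F G H)) }
      ; *-comm = λ F G → ≋⇒≃ (R.*-comm F G) } }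
    where module R = CommutativeRing ℤ[X]

  Φ≃0 : Φ ≃ []
  Φ≃0 = mod𝔞 (∈𝔞-resp (≡⇒≋ (sym (+ₚ-identityʳ Φ))) Φ∈𝔞)

  ≃-cancel-p^ : ∀ j {F G} → p^ j *ₚ F ≃ p^ j *ₚ G → F ≃ G
  ≃-cancel-p^ j {F} {G} (mod𝔞 d) = mod𝔞 (∈𝔞-saturated j (F -ₚ G) (∈𝔞-resp (factor (p^ j) F G) d))
    where
    factor : ∀ c F G → c *ₚ F -ₚ c *ₚ G ≋ c *ₚ (F -ₚ G)
    factor = solve-∀ ℤ[X]-solver

module CyclotomicFactorisation (p : ℕ) (Φ : Poly) where
  open Saturation p Φ
  module 𝔸 = CommutativeRing ℤ[X]/𝔞
  open SetoidReasoning 𝔸.setoid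
  open import Algebra.Properties.Semiring.Exp 𝔸.semiring
  open import Algebra.Properties.Monoid.Sum 𝔸.*-monoid using () renaming (sum to product)
  open import Algebra.Properties.Semiring.Sum 𝔸.semiring

  -- A sequence f stands for the polynomial Σᵢ f i Tⁱ in an auxiliary variable T; twist ω f is f(ωT).
  Seq : Set
  Seq = ℕ → Poly

  infix 4 _≈ₛ_
  _≈ₛ_ : Seq → Seq → Set
  f ≈ₛ g = ∀ i → f i ≃ g i

  1ₛ : Seq
  1ₛ zero    = 1ₚ
  1ₛ (suc i) = []

  mul[1-cT] : Poly → Seq → Seq
  mul[1-cT] c f zero    = f zero
  mul[1-cT] c f (suc i) = f (suc i) -ₚ c *ₚ f i

  ∏[1-aT] : (ℕ → Poly) → ℕ → Seq
  ∏[1-aT] a zero    = 1ₛ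
  ∏[1-aT] a (suc k) = mul[1-cT] (a 0) (∏[1-aT] (a ∘ suc) k)

  mul[1-cT]-cong : ∀ {c c′ f g} → c ≃ c′ → f ≈ₛ g → mul[1-cT] c f ≈ₛ mul[1-cT] c′ g
  mul[1-cT]-cong c≃c′ f≈g zero    = f≈g zero
  mul[1-cT]-cong c≃c′ f≈g (suc i) = 𝔸.+-cong (f≈g (suc i)) (𝔸.-‿cong (𝔸.*-cong c≃c′ (f≈g i)))

  mul[1-cT]-comm : ∀ c d f → mul[1-cT] c (mul[1-cT] d f) ≈ₛ mul[1-cT] d (mul[1-cT] c f)
  mul[1-cT]-comm c d f zero          = 𝔸.refl
  mul[1-cT]-comm c d f (suc zero)    = ≋⇒≃ (exchange c d (f 0) (f 1))
    where
    exchange : ∀ c d f₀ f₁ → (f₁ -ₚ d *ₚ f₀) -ₚ c *ₚ f₀ ≋ (f₁ -ₚ c *ₚ f₀) -ₚ d *ₚ f₀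
    exchange = solve-∀ ℤ[X]-solver
  mul[1-cT]-comm c d f (suc (suc i)) = ≋⇒≃ (exchange c d (f i) (f (suc i)) (f (suc (suc i))))
    where
    exchange : ∀ c d f₀ f₁ f₂ →
      (f₂ -ₚ d *ₚ f₁) -ₚ c *ₚ (f₁ -ₚ d *ₚ f₀) ≋ (f₂ -ₚ c *ₚ f₁) -ₚ d *ₚ (f₁ -ₚ c *ₚ f₀)
    exchange = solve-∀ ℤ[X]-solver

  ∏[1-aT]-snoc : ∀ a k → ∏[1-aT] a (suc k) ≈ₛ mul[1-cT] (a k) (∏[1-aT] a k)
  ∏[1-aT]-snoc a zero    i = 𝔸.refl
  ∏[1-aT]-snoc a (suc k) i = begin
    mul[1-cT] (a 0) (∏[1-aT] (a ∘ suc) (suc k)) i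
      ≈⟨ mul[1-cT]-cong 𝔸.refl (∏[1-aT]-snoc (a ∘ suc) k) i ⟩
    mul[1-cT] (a 0) (mul[1-cT] (a (suc k)) (∏[1-aT] (a ∘ suc) k)) i
      ≈⟨ mul[1-cT]-comm (a 0) (a (suc k)) _ i ⟩
    mul[1-cT] (a (suc k)) (∏[1-aT] a (suc k)) i ∎

  ∏[1-aT]-rotate : ∀ a k → a (suc k) ≃ a 0 → ∏[1-aT] (a ∘ suc) (suc k) ≈ₛ ∏[1-aT] a (suc k)
  ∏[1-aT]-rotate a k aₖ₊₁≃a₀ i = begin
    ∏[1-aT] (a ∘ suc) (suc k) i                            ≈⟨ ∏[1-aT]-snoc (a ∘ suc) k i ⟩
    mul[1-cT] (a (suc k)) (∏[1-aT] (a ∘ suc) k) i          ≈⟨ mul[1-cT]-cong aₖ₊₁≃a₀ (λ _ → 𝔸.refl) i ⟩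
    ∏[1-aT] a (suc k) i                                    ∎

  ∏[1-aT]-constant : ∀ a k → ∏[1-aT] a k 0 ≡ 1ₚ
  ∏[1-aT]-constant a zero    = refl
  ∏[1-aT]-constant a (suc k) = ∏[1-aT]-constant (a ∘ suc) k

  ∏[1-aT]-degree : ∀ a k i → k < i → ∏[1-aT] a k i ≃ []
  ∏[1-aT]-degree a zero    (suc i)       _         = 𝔸.refl
  ∏[1-aT]-degree a (suc k) (suc (suc i)) (s≤s k<i) = begin
    ∏[1-aT] (a ∘ suc) k (suc (suc i)) -ₚ a 0 *ₚ ∏[1-aT] (a ∘ suc) k (suc i)
      ≈⟨ 𝔸.+-cong (∏[1-aT]-degree (a ∘ suc) k (suc (suc i)) (ℕ.m<n⇒m<1+n k<i))
                  (𝔸.-‿cong (𝔸.*-congˡ {a 0} (∏[1-aT]-degree (a ∘ suc) k (suc i) k<i))) ⟩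
    [] -ₚ a 0 *ₚ []
      ≈⟨ ≋⇒≃ (vanish (a 0)) ⟩
    [] ∎
    where
    vanish : ∀ c → [] -ₚ c *ₚ [] ≋ []
    vanish = solve-∀ ℤ[X]-solver

  twist : Poly → Seq → Seq
  twist ω f i = ω ^ i *ₚ f i

  twist-mul[1-cT] : ∀ ω c f → twist ω (mul[1-cT] c f) ≈ₛ mul[1-cT] (ω *ₚ c) (twist ω f)
  twist-mul[1-cT] ω c f zero    = 𝔸.refl
  twist-mul[1-cT] ω c f (suc i) = ≋⇒≃ (distribute ω (ω ^ i) c (f i) (f (suc i)))
    where
    distribute : ∀ ω w c f₀ f₁ → (ω *ₚ w) *ₚ (f₁ -ₚ c *ₚ f₀) ≋ (ω *ₚ w) *ₚ f₁ -ₚ (ω *ₚ c) *ₚ (w *ₚ f₀)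
    distribute = solve-∀ ℤ[X]-solver

  twist-∏[1-aT] : ∀ ω a k → twist ω (∏[1-aT] a k) ≈ₛ ∏[1-aT] (λ j → ω *ₚ a j) k
  twist-∏[1-aT] ω a zero    zero    = 𝔸.*-identityʳ 1ₚ
  twist-∏[1-aT] ω a zero    (suc i) = 𝔸.zeroʳ (ω ^ suc i)
  twist-∏[1-aT] ω a (suc k) i = begin
    twist ω (mul[1-cT] (a 0) (∏[1-aT] (a ∘ suc) k)) i
      ≈⟨ twist-mul[1-cT] ω (a 0) _ i ⟩
    mul[1-cT] (ω *ₚ a 0) (twist ω (∏[1-aT] (a ∘ suc) k)) i
      ≈⟨ mul[1-cT]-cong 𝔸.refl (twist-∏[1-aT] ω (a ∘ suc) k) i ⟩
    ∏[1-aT] (λ j → ω *ₚ a j) (suc k) i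
      ∎

  eval : Poly → ℕ → Seq → Poly
  eval b zero    f = []
  eval b (suc N) f = f 0 +ₚ b *ₚ eval b N (f ∘ suc)

  eval-linear : ∀ b N c g h → eval b N (λ i → g i -ₚ c *ₚ h i) ≃ eval b N g -ₚ c *ₚ eval b N h
  eval-linear b zero    c g h = ≋⇒≃ (vanish c)
    where
    vanish : ∀ c → [] ≋ [] -ₚ c *ₚ []
    vanish = solve-∀ ℤ[X]-solver
  eval-linear b (suc N) c g h = begin
    (g 0 -ₚ c *ₚ h 0) +ₚ b *ₚ eval b N (λ i → g (suc i) -ₚ c *ₚ h (suc i))
      ≈⟨ 𝔸.+-congˡ (𝔸.*-congˡ {b} (eval-linear b N c (g ∘ suc) (h ∘ suc))) ⟩
    (g 0 -ₚ c *ₚ h 0) +ₚ b *ₚ (eval b N (g ∘ suc) -ₚ c *ₚ eval b N (h ∘ suc))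
      ≈⟨ ≋⇒≃ (regroup b c (g 0) (h 0) _ _) ⟩
    (g 0 +ₚ b *ₚ eval b N (g ∘ suc)) -ₚ c *ₚ (h 0 +ₚ b *ₚ eval b N (h ∘ suc)) ∎
    where
    regroup : ∀ b c g₀ h₀ G H → (g₀ -ₚ c *ₚ h₀) +ₚ b *ₚ (G -ₚ c *ₚ H) ≋ (g₀ +ₚ b *ₚ G) -ₚ c *ₚ (h₀ +ₚ b *ₚ H)
    regroup = solve-∀ ℤ[X]-solver

  eval-mul[1-cT] : ∀ b N c f →
    eval b (suc N) (mul[1-cT] c f) ≃ eval b (suc N) f -ₚ (c *ₚ b) *ₚ eval b N f
  eval-mul[1-cT] b N c f = begin
    f 0 +ₚ b *ₚ eval b N (λ i → f (suc i) -ₚ c *ₚ f i)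
      ≈⟨ 𝔸.+-congˡ (𝔸.*-congˡ {b} (eval-linear b N c (f ∘ suc) f)) ⟩
    f 0 +ₚ b *ₚ (eval b N (f ∘ suc) -ₚ c *ₚ eval b N f)
      ≈⟨ ≋⇒≃ (regroup b c (f 0) _ _) ⟩
    (f 0 +ₚ b *ₚ eval b N (f ∘ suc)) -ₚ (c *ₚ b) *ₚ eval b N f ∎
    where
    regroup : ∀ b c f₀ F₁ F → f₀ +ₚ b *ₚ (F₁ -ₚ c *ₚ F) ≋ (f₀ +ₚ b *ₚ F₁) -ₚ (c *ₚ b) *ₚ F
    regroup = solve-∀ ℤ[X]-solver

  eval-top : ∀ b N f → f N ≃ [] → eval b (suc N) f ≃ eval b N f
  eval-top b zero    f f₀≃0 = 𝔸.trans (𝔸.+-congʳ f₀≃0) (≋⇒≃ (vanish b))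
    where
    vanish : ∀ b → [] +ₚ b *ₚ [] ≋ []
    vanish = solve-∀ ℤ[X]-solver
  eval-top b (suc N) f fN≃0 = 𝔸.+-congˡ (𝔸.*-congˡ {b} (eval-top b N (f ∘ suc) fN≃0))

  eval-∏[1-aT] : ∀ b a k → eval b (suc k) (∏[1-aT] a k) ≃ product {k} (λ j → 1ₚ -ₚ a (toℕ j) *ₚ b)
  eval-∏[1-aT] b a zero    = ≋⇒≃ (unit b)
    where
    unit : ∀ b → 1ₚ +ₚ b *ₚ [] ≋ 1ₚ
    unit = solve-∀ ℤ[X]-solver
  eval-∏[1-aT] b a (suc k) = begin
    eval b (suc (suc k)) (mul[1-cT] (a 0) e)
      ≈⟨ eval-mul[1-cT] b (suc k) (a 0) e ⟩
    eval b (suc (suc k)) e -ₚ (a 0 *ₚ b) *ₚ eval b (suc k) e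
      ≈⟨ 𝔸.+-congʳ (eval-top b (suc k) e e-top≃0) ⟩
    eval b (suc k) e -ₚ (a 0 *ₚ b) *ₚ eval b (suc k) e
      ≈⟨ ≋⇒≃ (factor (a 0 *ₚ b) _) ⟩
    (1ₚ -ₚ a 0 *ₚ b) *ₚ eval b (suc k) e
      ≈⟨ 𝔸.*-congˡ {1ₚ -ₚ a 0 *ₚ b} (eval-∏[1-aT] b (a ∘ suc) k) ⟩
    product {suc k} (λ j → 1ₚ -ₚ a (toℕ j) *ₚ b)
      ∎
    where
    e : Seq
    e = ∏[1-aT] (a ∘ suc) k
    e-top≃0 : e (suc k) ≃ []
    e-top≃0 = ∏[1-aT]-degree (a ∘ suc) k (suc k) (ℕ.n<1+n k)
    factor : ∀ c F → F -ₚ c *ₚ F ≋ (1ₚ -ₚ c) *ₚ F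
    factor = solve-∀ ℤ[X]-solver

  eval-monomial : ∀ b M g → (∀ i → i < M → g i ≃ []) → eval b (suc M) g ≃ g M *ₚ b ^ M
  eval-monomial b zero    g _     = ≋⇒≃ (unit b (g 0))
    where
    unit : ∀ b g₀ → g₀ +ₚ b *ₚ [] ≋ g₀ *ₚ 1ₚ
    unit = solve-∀ ℤ[X]-solver
  eval-monomial b (suc M) g g<M≃0 = begin
    g 0 +ₚ b *ₚ eval b (suc M) (g ∘ suc)   ≈⟨ 𝔸.+-cong (g<M≃0 0 (s≤s z≤n)) (𝔸.*-congˡ {b} tail≃) ⟩
    [] +ₚ b *ₚ (g (suc M) *ₚ b ^ M)         ≈⟨ ≋⇒≃ (shift b (g (suc M)) (b ^ M)) ⟩
    g (suc M) *ₚ (b *ₚ b ^ M)               ∎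
    where
    tail≃ : eval b (suc M) (g ∘ suc) ≃ g (suc M) *ₚ b ^ M
    tail≃ = eval-monomial b M (g ∘ suc) (λ i i<M → g<M≃0 (suc i) (s≤s i<M))
    shift : ∀ b c w → [] +ₚ b *ₚ (c *ₚ w) ≋ c *ₚ (b *ₚ w)
    shift = solve-∀ ℤ[X]-solver

  1^n≃1 : ∀ n → 1ₚ ^ n ≃ 1ₚ
  1^n≃1 zero    = 𝔸.refl
  1^n≃1 (suc n) = 𝔸.trans (𝔸.*-identityˡ (1ₚ ^ n)) (1^n≃1 n)

  geometric-sum : ∀ ω k → (1ₚ -ₚ ω) *ₚ (∑[ i < k ] (ω ^ toℕ i)) ≃ 1ₚ -ₚ ω ^ k
  geometric-sum ω zero    = ≋⇒≃ (≋-trans (*ₚ-zeroʳ (1ₚ -ₚ ω)) (≋-sym (negₚ-inverseʳ 1ₚ)))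
  geometric-sum ω (suc k) = begin
    (1ₚ -ₚ ω) *ₚ (1ₚ +ₚ ∑[ i < k ] (ω *ₚ ω ^ toℕ i))
      ≈⟨ 𝔸.*-congˡ {1ₚ -ₚ ω} (𝔸.+-congˡ (𝔸.sym (*-distribˡ-sum {k} ω (λ i → ω ^ toℕ i)))) ⟩
    (1ₚ -ₚ ω) *ₚ (1ₚ +ₚ ω *ₚ S)                     ≈⟨ ≋⇒≃ (expand ω S) ⟩
    (1ₚ -ₚ ω) +ₚ ω *ₚ ((1ₚ -ₚ ω) *ₚ S)               ≈⟨ 𝔸.+-congˡ (𝔸.*-congˡ {ω} (geometric-sum ω k)) ⟩
    (1ₚ -ₚ ω) +ₚ ω *ₚ (1ₚ -ₚ ω ^ k)                  ≈⟨ ≋⇒≃ (collapse ω (ω ^ k)) ⟩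
    1ₚ -ₚ ω *ₚ ω ^ k                                 ∎
    where
    S : Poly
    S = ∑[ i < k ] (ω ^ toℕ i)
    expand : ∀ ω S → (1ₚ -ₚ ω) *ₚ (1ₚ +ₚ ω *ₚ S) ≋ (1ₚ -ₚ ω) +ₚ ω *ₚ ((1ₚ -ₚ ω) *ₚ S)
    expand = solve-∀ ℤ[X]-solver
    collapse : ∀ ω W → (1ₚ -ₚ ω) +ₚ ω *ₚ (1ₚ -ₚ W) ≋ 1ₚ -ₚ ω *ₚ W
    collapse = solve-∀ ℤ[X]-solver

  ∑-const : ∀ n e → ∑[ i < n ] e ≃ C (+ n) *ₚ e
  ∑-const zero    e = ≋⇒≃ (≋-sym (≋-trans (≋-sym (·ₚ≋C*ₚ (+ 0) e)) (·ₚ-zero e)))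
  ∑-const (suc n) e = 𝔸.trans (𝔸.+-congˡ (∑-const n e)) (≋⇒≃ (collect (C (+ n)) e))
    where
    collect : ∀ c e → e +ₚ c *ₚ e ≋ (1ₚ +ₚ c) *ₚ e
    collect = solve-∀ ℤ[X]-solver

  p-cancel : ∀ {e} → C (+ p) *ₚ e ≃ [] → e ≃ []
  p-cancel {e} pe≃0 = ≃-cancel-p^ 1 (begin
    p^ 1 *ₚ e       ≈⟨ 𝔸.*-congʳ (≋⇒≃ (≡⇒≋ (cong (C ∘ +_) (ℕ.*-identityʳ p)))) ⟩
    C (+ p) *ₚ e   ≈⟨ pe≃0 ⟩
    []             ≈⟨ ≋⇒≃ (≋-sym (*ₚ-zeroʳ (p^ 1))) ⟩
    p^ 1 *ₚ []      ∎)

  module PrimitiveRoot (p-prime : Prime p) (ω : Poly) (∑ω≃0 : ∑[ i < p ] (ω ^ toℕ i) ≃ []) where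

    ω^p≃1 : ω ^ p ≃ 1ₚ
    ω^p≃1 = begin
      ω ^ p                                           ≈⟨ ≋⇒≃ (double-negation (ω ^ p)) ⟩
      1ₚ -ₚ (1ₚ -ₚ ω ^ p)                             ≈⟨ 𝔸.+-congˡ (𝔸.-‿cong (𝔸.sym (geometric-sum ω p))) ⟩
      1ₚ -ₚ (1ₚ -ₚ ω) *ₚ (∑[ i < p ] (ω ^ toℕ i))    ≈⟨ 𝔸.+-congˡ (𝔸.-‿cong (𝔸.*-congˡ {1ₚ -ₚ ω} ∑ω≃0)) ⟩
      1ₚ -ₚ (1ₚ -ₚ ω) *ₚ []                           ≈⟨ ≋⇒≃ (vanish ω) ⟩
      1ₚ                                              ∎
      where
      double-negation : ∀ w → w ≋ 1ₚ -ₚ (1ₚ -ₚ w)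
      double-negation = solve-∀ ℤ[X]-solver
      vanish : ∀ ω → 1ₚ -ₚ (1ₚ -ₚ ω) *ₚ [] ≋ 1ₚ
      vanish = solve-∀ ℤ[X]-solver

    ω^[y*p]≃1 : ∀ y → ω ^ (y ℕ.* p) ≃ 1ₚ
    ω^[y*p]≃1 y = begin
      ω ^ (y ℕ.* p)   ≡⟨ cong (ω ^_) (ℕ.*-comm y p) ⟩
      ω ^ (p ℕ.* y)   ≈⟨ 𝔸.sym (^-assocʳ ω p y) ⟩
      (ω ^ p) ^ y     ≈⟨ ^-congˡ y ω^p≃1 ⟩
      1ₚ ^ y          ≈⟨ 1^n≃1 y ⟩
      1ₚ              ∎

    fixed-by-ω⇒zero : ∀ e → ω *ₚ e ≃ e → e ≃ []
    fixed-by-ω⇒zero e ωe≃e = p-cancel (begin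
      C (+ p) *ₚ e                    ≈⟨ 𝔸.sym (∑-const p e) ⟩
      ∑[ i < p ] e                    ≈⟨ sum-cong-≋ {p} (λ i → 𝔸.sym (fixed (toℕ i))) ⟩
      ∑[ i < p ] (ω ^ toℕ i *ₚ e)     ≈⟨ 𝔸.sym (*-distribʳ-sum {p} e (λ i → ω ^ toℕ i)) ⟩
      (∑[ i < p ] (ω ^ toℕ i)) *ₚ e   ≈⟨ 𝔸.*-congʳ ∑ω≃0 ⟩
      [] *ₚ e                         ≈⟨ 𝔸.refl ⟩
      []                              ∎)
      where
      fixed : ∀ i → ω ^ i *ₚ e ≃ e
      fixed zero    = 𝔸.*-identityˡ e
      fixed (suc i) = 𝔸.trans (𝔸.*-assoc ω (ω ^ i) e) (𝔸.trans (𝔸.*-congˡ {ω} (fixed i)) ωe≃e)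

    fixed-by-ω^m⇒zero : ∀ m e → 0 < m → m < p → ω ^ m *ₚ e ≃ e → e ≃ []
    fixed-by-ω^m⇒zero m@(suc _) e _ m<p ωᵐe≃e = fixed-by-ω⇒zero e ωe≃e
      where
      fixed : ∀ x → ω ^ (x ℕ.* m) *ₚ e ≃ e
      fixed zero    = 𝔸.*-identityˡ e
      fixed (suc x) = begin
        ω ^ (m ℕ.+ x ℕ.* m) *ₚ e          ≈⟨ 𝔸.*-congʳ (^-homo-* ω m (x ℕ.* m)) ⟩
        (ω ^ m *ₚ ω ^ (x ℕ.* m)) *ₚ e     ≈⟨ 𝔸.*-assoc (ω ^ m) _ e ⟩
        ω ^ m *ₚ (ω ^ (x ℕ.* m) *ₚ e)     ≈⟨ 𝔸.*-congˡ {ω ^ m} (fixed x) ⟩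
        ω ^ m *ₚ e                        ≈⟨ ωᵐe≃e ⟩
        e                                 ∎
      absorb : ∀ x → ω ^ (x ℕ.* p) *ₚ e ≃ e
      absorb x = 𝔸.trans (𝔸.*-congʳ (ω^[y*p]≃1 x)) (𝔸.*-identityˡ e)
      ωe≃e : ω *ₚ e ≃ e
      ωe≃e with coprime-Bézout (prime⇒coprime p-prime m<p)
      ... | Bézout.+- x y 1+ym≡xp = begin
        ω *ₚ e                          ≈⟨ 𝔸.*-congˡ {ω} (𝔸.sym (fixed y)) ⟩
        ω *ₚ (ω ^ (y ℕ.* m) *ₚ e)       ≈⟨ 𝔸.sym (𝔸.*-assoc ω _ e) ⟩
        ω ^ (1 ℕ.+ y ℕ.* m) *ₚ e        ≡⟨ cong (λ k → ω ^ k *ₚ e) 1+ym≡xp ⟩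
        ω ^ (x ℕ.* p) *ₚ e              ≈⟨ absorb x ⟩
        e                               ∎
      ... | Bézout.-+ x y 1+xp≡ym = begin
        ω *ₚ e                          ≈⟨ 𝔸.*-congˡ {ω} (𝔸.sym (absorb x)) ⟩
        ω *ₚ (ω ^ (x ℕ.* p) *ₚ e)       ≈⟨ 𝔸.sym (𝔸.*-assoc ω _ e) ⟩
        ω ^ (1 ℕ.+ x ℕ.* p) *ₚ e        ≡⟨ cong (λ k → ω ^ k *ₚ e) 1+xp≡ym ⟩
        ω ^ (y ℕ.* m) *ₚ e              ≈⟨ fixed y ⟩
        e                               ∎

    p′ : ℕ
    p′ = ℕ.pred p

    1+p′≡p : suc p′ ≡ p
    1+p′≡p = ℕ.suc-pred p {{prime⇒nonZero p-prime}}

    e : Seq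
    e = ∏[1-aT] (ω ^_) (suc p′)

    e-twist-invariant : ∀ i → ω ^ i *ₚ e i ≃ e i
    e-twist-invariant i = begin
      ω ^ i *ₚ e i                            ≈⟨ twist-∏[1-aT] ω (ω ^_) (suc p′) i ⟩
      ∏[1-aT] (λ j → ω ^ suc j) (suc p′) i    ≈⟨ ∏[1-aT]-rotate (ω ^_) p′ ω^[1+p′]≃1 i ⟩
      e i                                     ∎
      where
      ω^[1+p′]≃1 : ω ^ suc p′ ≃ 1ₚ
      ω^[1+p′]≃1 = subst (λ k → ω ^ k ≃ 1ₚ) (sym 1+p′≡p) ω^p≃1

    e-middle≃0 : ∀ i → 0 < i → i < suc p′ → e i ≃ []
    e-middle≃0 i 0<i i<p = fixed-by-ω^m⇒zero i (e i) 0<i (subst (i <_) 1+p′≡p i<p) (e-twist-invariant i)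

    ∏[1-ωʲb]≃1+eb^p : ∀ b → product {suc p′} (λ j → 1ₚ -ₚ ω ^ toℕ j *ₚ b) ≃ 1ₚ +ₚ e (suc p′) *ₚ b ^ suc p′
    ∏[1-ωʲb]≃1+eb^p b = begin
      product {suc p′} (λ j → 1ₚ -ₚ ω ^ toℕ j *ₚ b)
        ≈⟨ 𝔸.sym (eval-∏[1-aT] b (ω ^_) (suc p′)) ⟩
      e 0 +ₚ b *ₚ eval b (suc p′) (e ∘ suc)
        ≡⟨ cong (_+ₚ b *ₚ eval b (suc p′) (e ∘ suc)) (∏[1-aT]-constant (ω ^_) (suc p′)) ⟩
      1ₚ +ₚ b *ₚ eval b (suc p′) (e ∘ suc)
        ≈⟨ 𝔸.+-congˡ (𝔸.*-congˡ {b} (eval-monomial b p′ (e ∘ suc) λ i i<p′ →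
             e-middle≃0 (suc i) (s≤s z≤n) (s≤s i<p′))) ⟩
      1ₚ +ₚ b *ₚ (e (suc p′) *ₚ b ^ p′)
        ≈⟨ ≋⇒≃ (shift b (e (suc p′)) (b ^ p′)) ⟩
      1ₚ +ₚ e (suc p′) *ₚ (b *ₚ b ^ p′) ∎
      where
      shift : ∀ b c w → 1ₚ +ₚ b *ₚ (c *ₚ w) ≋ 1ₚ +ₚ c *ₚ (b *ₚ w)
      shift = solve-∀ ℤ[X]-solver

    e-top≃-1 : e (suc p′) ≃ negₚ 1ₚ
    e-top≃-1 = begin
      e (suc p′)
        ≈⟨ ≋⇒≃ (unshift (e (suc p′))) ⟩
      (1ₚ +ₚ e (suc p′) *ₚ 1ₚ) -ₚ 1ₚ
        ≈⟨ 𝔸.+-congʳ {negₚ 1ₚ} (𝔸.+-congˡ {1ₚ} (𝔸.*-congˡ {e (suc p′)} (𝔸.sym (1^n≃1 (suc p′))))) ⟩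
      (1ₚ +ₚ e (suc p′) *ₚ 1ₚ ^ suc p′) -ₚ 1ₚ
        ≈⟨ 𝔸.+-congʳ {negₚ 1ₚ} (𝔸.trans (𝔸.sym (∏[1-ωʲb]≃1+eb^p 1ₚ)) P[1]≃0) ⟩
      [] -ₚ 1ₚ
        ∎
      where
      unshift : ∀ e → e ≋ (1ₚ +ₚ e *ₚ 1ₚ) -ₚ 1ₚ
      unshift = solve-∀ ℤ[X]-solver
      -- the factor j = 0 is 1 − 1·1
      P[1]≃0 : product {suc p′} (λ j → 1ₚ -ₚ ω ^ toℕ j *ₚ 1ₚ) ≃ []
      P[1]≃0 = 𝔸.trans (𝔸.*-congʳ (≋⇒≃ (∷-zero refl ≋-refl)))
        (𝔸.zeroˡ (product {p′} (λ j → 1ₚ -ₚ ω ^ suc (toℕ j) *ₚ 1ₚ)))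

    cyclotomic-factorisation : ∀ b → product {p} (λ j → 1ₚ -ₚ ω ^ toℕ j *ₚ b) ≃ 1ₚ -ₚ b ^ p
    cyclotomic-factorisation b =
      subst (λ k → product {k} (λ j → 1ₚ -ₚ ω ^ toℕ j *ₚ b) ≃ 1ₚ -ₚ b ^ k) 1+p′≡p (begin
      product {suc p′} (λ j → 1ₚ -ₚ ω ^ toℕ j *ₚ b)   ≈⟨ ∏[1-ωʲb]≃1+eb^p b ⟩
      1ₚ +ₚ e (suc p′) *ₚ b ^ suc p′                  ≈⟨ 𝔸.+-congˡ (𝔸.*-congʳ e-top≃-1) ⟩
      1ₚ +ₚ negₚ 1ₚ *ₚ b ^ suc p′                      ≈⟨ ≋⇒≃ (sign (b ^ suc p′)) ⟩
      1ₚ -ₚ b ^ suc p′                                ∎)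
      where
      sign : ∀ w → 1ₚ +ₚ negₚ 1ₚ *ₚ w ≋ 1ₚ -ₚ w
      sign = solve-∀ ℤ[X]-solver

module Localisation (p n : ℕ) where
  open Cyclo p n using (R; _/p^_; _≈_; _*R_; _+R_; 1R; IsUnit)
  open Saturation p (Cyclo.Φ p n)
  module 𝔸 = CommutativeRing ℤ[X]/𝔞
  open SetoidReasoning 𝔸.setoid

  ≈⇒≃ : ∀ f k g l → (f /p^ k) ≈ (g /p^ l) → p^ l *ₚ f ≃ p^ k *ₚ g
  ≈⇒≃ f k g l e =
    mod𝔞 (∈𝔞-resp (+ₚ-cong (·ₚ≋C*ₚ (pow l) f) (·ₚ-congʳ (- + 1) (·ₚ≋C*ₚ (pow k) g))) (saturation e))

  ≃⇒≈ : ∀ f k g l → p^ l *ₚ f ≃ p^ k *ₚ g → (f /p^ k) ≈ (g /p^ l)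
  ≃⇒≈ f k g l (mod𝔞 d) = _∈𝔞.certificate
    (∈𝔞-resp (+ₚ-cong (≋-sym (·ₚ≋C*ₚ (pow l) f)) (·ₚ-congʳ (- + 1) (≋-sym (·ₚ≋C*ₚ (pow k) g)))) d)

  ι : Poly → R
  ι F = F /p^ 0

  ι-cong : ∀ {F G} → F ≃ G → ι F ≈ ι G
  ι-cong {F} {G} F≃G = ≃⇒≈ F 0 G 0 (𝔸.*-congˡ {p^ 0} F≃G)

  ≈-refl : ∀ {x} → x ≈ x
  ≈-refl {f /p^ k} = ≃⇒≈ f k f k 𝔸.refl

  ≈-sym : ∀ {x y} → x ≈ y → y ≈ x
  ≈-sym {f /p^ k} {g /p^ l} x≈y = ≃⇒≈ g l f k (𝔸.sym (≈⇒≃ f k g l x≈y))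

  ≈-trans : ∀ {x y z} → x ≈ y → y ≈ z → x ≈ z
  ≈-trans {f /p^ k} {g /p^ l} {h /p^ j} x≈y y≈z = ≃⇒≈ f k h j (≃-cancel-p^ l (begin
    p^ l *ₚ (p^ j *ₚ f)   ≈⟨ ≋⇒≃ (swap (p^ l) (p^ j) f) ⟩
    p^ j *ₚ (p^ l *ₚ f)   ≈⟨ 𝔸.*-congˡ {p^ j} (≈⇒≃ f k g l x≈y) ⟩
    p^ j *ₚ (p^ k *ₚ g)   ≈⟨ ≋⇒≃ (swap (p^ j) (p^ k) g) ⟩
    p^ k *ₚ (p^ j *ₚ g)   ≈⟨ 𝔸.*-congˡ {p^ k} (≈⇒≃ g l h j y≈z) ⟩
    p^ k *ₚ (p^ l *ₚ h)   ≈⟨ ≋⇒≃ (swap (p^ k) (p^ l) h) ⟩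
    p^ l *ₚ (p^ k *ₚ h)   ∎))
    where
    swap : ∀ a b f → a *ₚ (b *ₚ f) ≋ b *ₚ (a *ₚ f)
    swap = solve-∀ ℤ[X]-solver

  *R-cong : ∀ {x x′ y y′} → x ≈ x′ → y ≈ y′ → x *R y ≈ x′ *R y′
  *R-cong {f /p^ k} {f′ /p^ k′} {g /p^ l} {g′ /p^ l′} x≈x′ y≈y′ =
    ≃⇒≈ (f *ₚ g) (k ℕ.+ l) (f′ *ₚ g′) (k′ ℕ.+ l′) (begin
    p^ (k′ ℕ.+ l′) *ₚ (f *ₚ g)        ≈⟨ 𝔸.*-congʳ (≋⇒≃ (p^-+ k′ l′)) ⟩
    (p^ k′ *ₚ p^ l′) *ₚ (f *ₚ g)       ≈⟨ ≋⇒≃ (interchange (p^ k′) (p^ l′) f g) ⟩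
    (p^ k′ *ₚ f) *ₚ (p^ l′ *ₚ g)       ≈⟨ 𝔸.*-cong (≈⇒≃ f k f′ k′ x≈x′) (≈⇒≃ g l g′ l′ y≈y′) ⟩
    (p^ k *ₚ f′) *ₚ (p^ l *ₚ g′)       ≈⟨ ≋⇒≃ (≋-sym (interchange (p^ k) (p^ l) f′ g′)) ⟩
    (p^ k *ₚ p^ l) *ₚ (f′ *ₚ g′)       ≈⟨ 𝔸.*-congʳ (≋⇒≃ (≋-sym (p^-+ k l))) ⟩
    p^ (k ℕ.+ l) *ₚ (f′ *ₚ g′)        ∎)
    where
    interchange : ∀ a b f g → (a *ₚ b) *ₚ (f *ₚ g) ≋ (a *ₚ f) *ₚ (b *ₚ g)
    interchange = solve-∀ ℤ[X]-solver

  *R-assoc : ∀ x y z → (x *R y) *R z ≈ x *R (y *R z)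
  *R-assoc (f /p^ k) (g /p^ l) (h /p^ j) =
    ≃⇒≈ ((f *ₚ g) *ₚ h) ((k ℕ.+ l) ℕ.+ j) (f *ₚ (g *ₚ h)) (k ℕ.+ (l ℕ.+ j))
      (𝔸.*-cong (≋⇒≃ (≡⇒≋ (cong p^ (sym (ℕ.+-assoc k l j))))) (𝔸.*-assoc f g h))

  *R-comm : ∀ x y → x *R y ≈ y *R x
  *R-comm (f /p^ k) (g /p^ l) =
    ≃⇒≈ (f *ₚ g) (k ℕ.+ l) (g *ₚ f) (l ℕ.+ k) (𝔸.*-cong (≋⇒≃ (≡⇒≋ (cong p^ (ℕ.+-comm l k)))) (𝔸.*-comm f g))

  IsUnit-resp : ∀ {x y} → x ≈ y → IsUnit x → IsUnit y
  IsUnit-resp {x} {y} x≈y (x⁻¹ , xx⁻¹≈1) =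
    x⁻¹ , ≈-trans {y *R x⁻¹} {x *R x⁻¹} {1R}
            (*R-cong {y} {x} {x⁻¹} {x⁻¹} (≈-sym {x} {y} x≈y) (≈-refl {x⁻¹})) xx⁻¹≈1

  IsUnit-*ˡ : ∀ x y → IsUnit (x *R y) → IsUnit x
  IsUnit-*ˡ x y (w , xyw≈1) =
    y *R w , ≈-trans {x *R (y *R w)} {(x *R y) *R w} {1R}
               (≈-sym {(x *R y) *R w} {x *R (y *R w)} (*R-assoc x y w)) xyw≈1

  IsUnit-*ʳ : ∀ x y → IsUnit (x *R y) → IsUnit y
  IsUnit-*ʳ x y xy-unit = IsUnit-*ˡ y x (IsUnit-resp {x *R y} {y *R x} (*R-comm x y) xy-unit)

module Milnor (p n : ℕ) where
  open Cyclo p n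
  open Localisation p n

  K₂ : AbelianGroup _ _
  K₂ = record
    { Carrier = K2Expr ; _≈_ = _∼_ ; _∙_ = _⊕_ ; ε = 𝟘 ; _⁻¹ = ⊖_
    ; isAbelianGroup = record
      { isGroup = record
        { isMonoid = record
          { isSemigroup = record
            { isMagma = record
              { isEquivalence = record { refl = ∼-refl ; sym = ∼-sym ; trans = ∼-trans }
              ; ∙-cong = ⊕-cong }
            ; assoc = ⊕-assoc }
          ; identity = ⊕-idˡ , λ e → ∼-trans (⊕-comm e 𝟘) (⊕-idˡ e) }
        ; inverse = ⊖-invˡ , λ e → ∼-trans (⊕-comm e (⊖ e)) (⊖-invˡ e)
        ; ⁻¹-cong = ⊖-cong }
      ; comm = ⊕-comm } }

  open AbelianGroup K₂ using (identityʳ)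
  open import Algebra.Properties.Group (AbelianGroup.group K₂) using (identityʳ-unique)
  open SetoidReasoning (AbelianGroup.setoid K₂)

  Vanishes : R → R → Set
  Vanishes c z = ∀ u v → sym⟨ unit c u , unit z v ⟩ ∼ 𝟘

  Vanishes-respˡ : ∀ {c c′ z} → c ≈ c′ → Vanishes c z → Vanishes c′ z
  Vanishes-respˡ {c} {c′} {z} c≈c′ c-vanishes u′ v = ∼-trans
    (sym-cong _ _ _ _ (≈-sym {c} {c′} c≈c′) (≈-refl {z}))
    (c-vanishes (IsUnit-resp {c′} {c} (≈-sym {c} {c′} c≈c′) u′) v)

  Vanishes-respʳ : ∀ {c z z′} → z ≈ z′ → Vanishes c z → Vanishes c z′
  Vanishes-respʳ {c} {z} {z′} z≈z′ z-vanishes u v′ = ∼-trans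
    (sym-cong _ _ _ _ (≈-refl {c}) (≈-sym {z} {z′} z≈z′))
    (z-vanishes u (IsUnit-resp {z′} {z} (≈-sym {z} {z′} z≈z′) v′))

  Vanishes-1ˡ : ∀ z → Vanishes 1R z
  Vanishes-1ˡ z u v =
    identityʳ-unique _ _ (∼-sym (bilinˡ (unit 1R u) (unit 1R u) (unit z v) (unit 1R u) (≈-refl {1R})))

  Vanishes-1ʳ : ∀ c → Vanishes c 1R
  Vanishes-1ʳ c u v =
    identityʳ-unique _ _ (∼-sym (bilinʳ (unit 1R v) (unit 1R v) (unit c u) (unit 1R v) (≈-refl {1R})))

  Vanishes-*ˡ : ∀ {a b z} → Vanishes a z → Vanishes b z → Vanishes (a *R b) z
  Vanishes-*ˡ {a} {b} {z} a-vanishes b-vanishes u v = begin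
    sym⟨ unit (a *R b) u , unit z v ⟩
      ≈⟨ bilinˡ (unit a a-unit) (unit b b-unit) (unit z v) (unit (a *R b) u) (≈-refl {a *R b}) ⟩
    sym⟨ unit a a-unit , unit z v ⟩ ⊕ sym⟨ unit b b-unit , unit z v ⟩
      ≈⟨ ⊕-cong (a-vanishes a-unit v) (b-vanishes b-unit v) ⟩
    𝟘 ⊕ 𝟘
      ≈⟨ ⊕-idˡ 𝟘 ⟩
    𝟘 ∎
    where
    a-unit : IsUnit a
    a-unit = IsUnit-*ˡ a b u
    b-unit : IsUnit b
    b-unit = IsUnit-*ʳ a b u

  Vanishes-*ʳ : ∀ {c a b} → Vanishes c a → Vanishes c b → Vanishes c (a *R b)
  Vanishes-*ʳ {c} {a} {b} a-vanishes b-vanishes u v = begin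
    sym⟨ unit c u , unit (a *R b) v ⟩
      ≈⟨ bilinʳ (unit a a-unit) (unit b b-unit) (unit c u) (unit (a *R b) v) (≈-refl {a *R b}) ⟩
    sym⟨ unit c u , unit a a-unit ⟩ ⊕ sym⟨ unit c u , unit b b-unit ⟩
      ≈⟨ ⊕-cong (a-vanishes u a-unit) (b-vanishes u b-unit) ⟩
    𝟘 ⊕ 𝟘
      ≈⟨ ⊕-idˡ 𝟘 ⟩
    𝟘 ∎
    where
    a-unit : IsUnit a
    a-unit = IsUnit-*ˡ a b v
    b-unit : IsUnit b
    b-unit = IsUnit-*ʳ a b v

  Vanishes-inverse : ∀ {c a b} → Vanishes c a → b *R a ≈ 1R → Vanishes c b
  Vanishes-inverse {c} {a} {b} a-vanishes ba≈1 u v = begin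
    sym⟨ c′ , unit b v ⟩
      ≈⟨ ∼-sym (identityʳ _) ⟩
    sym⟨ c′ , unit b v ⟩ ⊕ 𝟘
      ≈⟨ ⊕-cong ∼-refl (∼-sym (a-vanishes u a-unit)) ⟩
    sym⟨ c′ , unit b v ⟩ ⊕ sym⟨ c′ , unit a a-unit ⟩
      ≈⟨ ∼-sym (bilinʳ (unit b v) (unit a a-unit) c′ (unit 1R (1R , ≈-refl {1R})) (≈-sym {b *R a} {1R} ba≈1)) ⟩
    sym⟨ c′ , unit 1R (1R , ≈-refl {1R}) ⟩
      ≈⟨ Vanishes-1ʳ c u _ ⟩
    𝟘 ∎
    where
    c′ : Unit
    c′ = unit c u
    a-unit : IsUnit a
    a-unit = b , ≈-trans {a *R b} {b *R a} {1R} (*R-comm a b) ba≈1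

module RootOfUnitySymbols (p n′ : ℕ) (p-prime : Prime p) where
  open Cyclo p (suc n′)
  open Saturation p Φ using (_≃_; ≋⇒≃; Φ≃0; ℤ[X]/𝔞)
  open Localisation p (suc n′)
  open Milnor p (suc n′)
  open import Algebra.Properties.Monoid.Sum 𝔸.*-monoid using () renaming (sum to product)
  open import Algebra.Properties.Semiring.Exp 𝔸.semiring using (_^_)
  open import Algebra.Properties.Semiring.Sum 𝔸.semiring using (sum; sum-syntax; sum-cong-≋)
  open SetoidReasoning 𝔸.setoid

  q : ℕ
  q = p ℕ.^ n′

  ω : Poly
  ω = X^ q

  X^-* : ∀ i c → X^ (i ℕ.* c) ≋ X^ c ^ i
  X^-* zero    c = ≋-refl
  X^-* (suc i) c = ≋-trans (X^-+ c (i ℕ.* c)) (*ₚ-congʳ (X^ c) (X^-* i c))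

  foldr-upTo : ∀ (F : ℕ → Poly) h k → foldr (λ i acc → F i +ₚ acc) [] (applyUpTo h k) ≡ ∑[ i < k ] F (h (toℕ i))
  foldr-upTo F h zero    = refl
  foldr-upTo F h (suc k) = cong (F (h 0) +ₚ_) (foldr-upTo F (h ∘ suc) k)

  ∑ωⁱ≃0 : ∑[ i < p ] (ω ^ toℕ i) ≃ []
  ∑ωⁱ≃0 = begin
    ∑[ i < p ] (ω ^ toℕ i)           ≈⟨ sum-cong-≋ {p} (λ i → ≋⇒≃ (≋-sym (X^-* (toℕ i) q))) ⟩
    ∑[ i < p ] X^ (toℕ i ℕ.* q)      ≡⟨ sym (foldr-upTo (λ i → X^ (i ℕ.* q)) (λ i → i) p) ⟩
    Φ                                ≈⟨ Φ≃0 ⟩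
    []                               ∎

  open CyclotomicFactorisation.PrimitiveRoot p Φ p-prime ω ∑ωⁱ≃0 using (ω^[y*p]≃1; cyclotomic-factorisation)

  N : ℕ
  N = p ℕ.^ suc n′

  X^[x*N]≃1 : ∀ x → X^ (x ℕ.* N) ≃ 1ₚ
  X^[x*N]≃1 x = begin
    X^ (x ℕ.* N)             ≡⟨ cong X^ (sym (ℕ.*-assoc x p q)) ⟩
    X^ (x ℕ.* p ℕ.* q)       ≈⟨ ≋⇒≃ (X^-* (x ℕ.* p) q) ⟩
    ω ^ (x ℕ.* p)            ≈⟨ ω^[y*p]≃1 x ⟩
    1ₚ                       ∎

  ζ^-+ : ∀ a b → ζ^ a *R ζ^ b ≈ ζ^ (a ℕ.+ b)
  ζ^-+ a b = ι-cong (≋⇒≃ (≋-sym (X^-+ a b)))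

  1-ζ^≡ι : ∀ t → 1R -R ζ^ t ≡ ι (1ₚ -ₚ X^ t)
  1-ζ^≡ι t = cong₂ (λ f g → (f +ₚ g) /p^ 0) (·ₚ-identity 1ₚ) (·ₚ-identity (negₚ (X^ t)))

  Vanishes-Steinberg : ∀ s → Vanishes (1R -R ζ^ s) (ζ^ s)
  Vanishes-Steinberg s u v = steinberg (unit (1R -R ζ^ s) u) (unit (ζ^ s) v) (inj₂ sum≈1)
    where
    cancel : ∀ w → (1ₚ -ₚ w) +ₚ w ≋ 1ₚ
    cancel = solve-∀ ℤ[X]-solver
    sum≈1 : (1R -R ζ^ s) +R ζ^ s ≈ 1R
    sum≈1 = subst (λ x → x +R ζ^ s ≈ 1R) (sym (1-ζ^≡ι s))
      (ι-cong (≋⇒≃ (≋-trans (+ₚ-cong (≡⇒≋ (·ₚ-identity (1ₚ -ₚ X^ s))) (≡⇒≋ (·ₚ-identity (X^ s))))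
                            (cancel (X^ s)))))

  Vanishes-ζ^-* : ∀ {c t} → Vanishes c (ζ^ t) → ∀ m → Vanishes c (ζ^ (m ℕ.* t))
  Vanishes-ζ^-* {c} {t} t-vanishes zero    = Vanishes-1ʳ c
  Vanishes-ζ^-* {c} {t} t-vanishes (suc m) = Vanishes-respʳ {c} {ζ^ t *R ζ^ (m ℕ.* t)} (ζ^-+ t (m ℕ.* t))
    (Vanishes-*ʳ {c} {ζ^ t} {ζ^ (m ℕ.* t)} t-vanishes (Vanishes-ζ^-* t-vanishes m))

  Vanishes-generator : ∀ {c s} → ¬ p ∣ s → Vanishes c (ζ^ s) → Vanishes c (ζ^ 1)
  Vanishes-generator {c} {s} p∤s s-vanishes
    with coprime-Bézout (coprime-^ (prime∤⇒coprime p-prime p∤s) (suc n′))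
  ... | Bézout.+- x y 1+ys≡xN =
    Vanishes-inverse {c} {ζ^ (y ℕ.* s)} {ζ^ 1} (Vanishes-ζ^-* s-vanishes y) (ι-cong (begin
    X^ 1 *ₚ X^ (y ℕ.* s)         ≈⟨ ≋⇒≃ (≋-sym (X^-+ 1 (y ℕ.* s))) ⟩
    X^ (1 ℕ.+ y ℕ.* s)           ≡⟨ cong X^ 1+ys≡xN ⟩
    X^ (x ℕ.* N)                 ≈⟨ X^[x*N]≃1 x ⟩
    1ₚ                           ∎))
  ... | Bézout.-+ x y 1+xN≡ys = Vanishes-respʳ {c} {ζ^ (y ℕ.* s)} (ι-cong (begin
    X^ (y ℕ.* s)                 ≡⟨ cong X^ (sym 1+xN≡ys) ⟩
    X^ (1 ℕ.+ x ℕ.* N)           ≈⟨ ≋⇒≃ (X^-+ 1 (x ℕ.* N)) ⟩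
    X^ 1 *ₚ X^ (x ℕ.* N)         ≈⟨ 𝔸.*-congˡ {X^ 1} (X^[x*N]≃1 x) ⟩
    X^ 1 *ₚ 1ₚ                   ≈⟨ 𝔸.*-identityʳ (X^ 1) ⟩
    X^ 1                         ∎)) (Vanishes-ζ^-* s-vanishes y)

  Vanishes-product : ∀ {z} k (f : Fin k → Poly) → (∀ j → Vanishes (ι (f j)) z) → Vanishes (ι (product f)) z
  Vanishes-product {z} zero    f _           = Vanishes-1ˡ z
  Vanishes-product {z} (suc k) f f-vanishes =
    Vanishes-*ˡ {ι (f Fin.zero)} (f-vanishes Fin.zero) (Vanishes-product k (f ∘ Fin.suc) (f-vanishes ∘ Fin.suc))

  1-ζ^s-vanishes : ∀ k s → k < suc n′ → ¬ p ℕ.^ suc k ∣ s → Vanishes (1R -R ζ^ s) (ζ^ 1)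
  1-ζ^s-vanishes k s _ _ with p ∣? s
  ... | no p∤s = Vanishes-generator p∤s (Vanishes-Steinberg s)
  1-ζ^s-vanishes zero    s _ p∤s | yes p∣s = contradiction (subst (_∣ s) (sym (ℕ.*-identityʳ p)) p∣s) p∤s
  1-ζ^s-vanishes (suc k) s (s≤s k<n′) p^[2+k]∤s | yes (divides s₁ s≡s₁p) =
    subst (λ x → Vanishes x (ζ^ 1)) (sym (1-ζ^≡ι s))
      (Vanishes-respˡ {ι (product factor)} (ι-cong product≃1-X^s) (Vanishes-product p factor factor-vanishes))
    where
    factor : Fin p → Poly
    factor j = 1ₚ -ₚ ω ^ toℕ j *ₚ X^ s₁
    product≃1-X^s : product factor ≃ 1ₚ -ₚ X^ s
    product≃1-X^s = begin
      product factor          ≈⟨ cyclotomic-factorisation (X^ s₁) ⟩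
      1ₚ -ₚ X^ s₁ ^ p         ≈⟨ 𝔸.+-congˡ (𝔸.-‿cong (≋⇒≃ (≋-sym (X^-* p s₁)))) ⟩
      1ₚ -ₚ X^ (p ℕ.* s₁)     ≡⟨ cong (λ t → 1ₚ -ₚ X^ t) (trans (ℕ.*-comm p s₁) (sym s≡s₁p)) ⟩
      1ₚ -ₚ X^ s              ∎
    factor-vanishes : ∀ j → Vanishes (ι (factor j)) (ζ^ 1)
    factor-vanishes j =
      Vanishes-respˡ {1R -R ζ^ t} (subst (_≈ ι (factor j)) (sym (1-ζ^≡ι t)) (ι-cong 1-X^t≃factor))
        (1-ζ^s-vanishes k t (ℕ.m<n⇒m<1+n k<n′) p^[1+k]∤t)
      where
      t : ℕ
      t = toℕ j ℕ.* q ℕ.+ s₁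
      1-X^t≃factor : 1ₚ -ₚ X^ t ≃ factor j
      1-X^t≃factor =
        𝔸.+-congˡ (𝔸.-‿cong (≋⇒≃ (≋-trans (X^-+ (toℕ j ℕ.* q) s₁) (*ₚ-cong (X^-* (toℕ j) q) ≋-refl))))
      p^[1+k]∤t : ¬ p ℕ.^ suc k ∣ t
      p^[1+k]∤t p^[1+k]∣t = p^[2+k]∤s (subst (p ℕ.^ suc (suc k) ∣_) (trans (ℕ.*-comm p s₁) (sym s≡s₁p))
        (*-monoʳ-∣ p (∣m+n∣m⇒∣n p^[1+k]∣t (∣n⇒∣m*n (toℕ j) (^-monoʳ-∣ p k<n′)))))

  symbol-vanishes : (x y : Fin N) → toℕ x ≢ 0 →
                    ∀ u v → sym⟨ unit (1R -R ζ^ (toℕ x)) u , unit (ζ^ (toℕ y)) v ⟩ ∼ 𝟘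
  symbol-vanishes x y x≢0 = subst (Vanishes (1R -R ζ^ (toℕ x)) ∘ ζ^) (ℕ.*-identityʳ (toℕ y))
    (Vanishes-ζ^-* (1-ζ^s-vanishes n′ (toℕ x) (ℕ.n<1+n n′) p^n∤x) (toℕ y))
    where
    p^n∤x : ¬ N ∣ toℕ x
    p^n∤x N∣x = ℕ.<⇒≱ (toℕ<n x) (∣⇒≤ {{ℕ.≢-nonZero x≢0}} N∣x)

open import Data.Nat using (_^_)

lemma4p2 : (p n : ℕ) → Prime p → 1 ≤ n →
    (x y : Fin (p ^ n)) → toℕ x ≢ 0 →
    (u : Cyclo.IsUnit p n (Cyclo._-R_ p n (Cyclo.1R p n) (Cyclo.ζ^ p n (toℕ x)))) →
    (v : Cyclo.IsUnit p n (Cyclo.ζ^ p n (toℕ y))) →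
    Cyclo._∼_ p n
      (Cyclo.sym⟨_,_⟩ {p} {n}
        (Cyclo.unit {p} {n} (Cyclo._-R_ p n (Cyclo.1R p n) (Cyclo.ζ^ p n (toℕ x))) u)
        (Cyclo.unit {p} {n} (Cyclo.ζ^ p n (toℕ y)) v))
      (Cyclo.𝟘 {p} {n})
lemma4p2 p zero     p-prime ()
lemma4p2 p (suc n′) p-prime _  = RootOfUnitySymbols.symbol-vanishes p n′ p-prime
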